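{- Let $f:S\to T$ be a weak topological embedding of $\mathcal{A}$-trees. Then: (i) $\mathcal{L}(S)=\mathcal{L}(T|\mathcal{A}(S))$; (ii) $f(V(S))\subseteq V(T|\mathcal{A}(S))$, and $f$, regarded as a map $V(S)\to V(T|\mathcal{A}(S))$, is a weak topological embedding $S\to T|\mathcal{A}(S)$.
   Context: A tree is a finite directed graph that is either empty or has a distinguished root $r$ such that for every node $v$ there is exactly one directed path from $r$ to $v$. A path may be trivial. If there is a path $v\rightsquigarrow w$, $w$ is a descendant of $v$. Leaves have no children. Fix a set $\mathcal{A}$ of labels. An $\mathcal{A}$-tree is a tree some of whose nodes, including all leaves, are injectively labeled by elements of $\mathcal{A}$. For an $\mathcal{A}$-tree $T$: $\mathcal{A}(T)$ is the set of labels of its nodes, $\mathcal{L}(T)$ the set of labels of its leaves, $v_{T,A}$ the node labeled $A$, and $\mathcal{A}_T(v)$ the set of labels of the descendants of $v$ (including $v$). For $\mathcal{X}\subseteq\mathcal{A}$, the restriction $T|\mathcal{X}$ is the subtree of $T$ on the nodes $v$ with $\mathcal{A}_T(v)\cap\mathcal{X}\neq\emptyset$, a node being labeled iff it is labeled in $T$ by a label in $\mathcal{X}$, with that label. A weak topological embedding $f:S\to T$ is a map $V(S)\to V(T)$ that is injective, preserves labels (for every $A\in\mathcal{A}(S)$, $A\in\mathcal{A}(T)$ and $f(v_{S,A})=v_{T,A}$), and preserves and reflects paths (for all $a,b\in V(S)$, there is a path $a\rightsquigarrow b$ in $S$ iff there is a path $f(a)\rightsquigarrow f(b)$ in $T$).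 -}

module Defs where

open import Data.Empty using (⊥)
open import Data.Sum using (_⊎_)
open import Data.Product using (Σ; ∃; ∃-syntax; _×_; _,_; proj₁)
open import Data.List using (List)
open import Data.List.Membership.Propositional using (_∈_)
open import Function.Bundles using (_⇔_)
open import Relation.Nullary using (¬_)
open import Relation.Binary.PropositionalEquality using (_≡_)

data Path {V : Set} (E : V → V → Set) : V → V → Set where
  [] : ∀ {v} → Path E v v
  _∷_ : ∀ {u v w} → E u v → Path E v w → Path E u w

record LGraph (𝒜 : Set) : Set₁ where
  field
    V   : Set
    E   : V → V → Set
    Lab : V → 𝒜 → Set
open LGraph public

module _ {𝒜 : Set} (G : LGraph 𝒜) where
  _⇝_ : V G → V G → Set
  v ⇝ w = Path (E G) v w

  IsLeaf : V G → Set
  IsLeaf v = ∀ w → ¬ E G v w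

  Labels : 𝒜 → Set
  Labels A = ∃[ v ] Lab G v A

  LeafLabels : 𝒜 → Set
  LeafLabels A = ∃[ v ] (IsLeaf v × Lab G v A)

  DescLabels : V G → 𝒜 → Set
  DescLabels v A = ∃[ w ] (v ⇝ w × Lab G w A)

  Finite : Set
  Finite = Σ (List (V G)) λ xs → ∀ v → v ∈ xs

  InjLabelled : Set
  InjLabelled = (∀ v A B → Lab G v A → Lab G v B → A ≡ B)
              × (∀ v w A → Lab G v A → Lab G w A → v ≡ w)

  AllLeavesLabelled : Set
  AllLeavesLabelled = ∀ v → IsLeaf v → ∃[ A ] Lab G v A

  IsTree : Set
  IsTree = (V G → ⊥)
         ⊎ (Σ (V G) λ r → ∀ v → Σ (r ⇝ v) λ p → ∀ (q : r ⇝ v) → q ≡ p)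

record IsATree {𝒜 : Set} (G : LGraph 𝒜) : Set where
  field
    finite   : Finite G
    tree     : IsTree G
    injLab   : InjLabelled G
    leavesLab : AllLeavesLabelled G

InRestr : {𝒜 : Set} (T : LGraph 𝒜) (X : 𝒜 → Set) → V T → Set
InRestr T X v = ∃[ A ] (X A × DescLabels T v A)

restrict : {𝒜 : Set} (T : LGraph 𝒜) (X : 𝒜 → Set) → LGraph 𝒜
restrict T X = record
  { V   = Σ (V T) (InRestr T X)
  ; E   = λ a b → E T (proj₁ a) (proj₁ b)
  ; Lab = λ a A → Lab T (proj₁ a) A × X A
  }

record IsWTE {𝒜 : Set} (S T : LGraph 𝒜) (f : V S → V T) : Set where
  field
    injective : ∀ a b → f a ≡ f b → a ≡ b
    preservesLabels : ∀ v A → Lab S v A → Lab T (f v) A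
    pathsIff : ∀ a b → (_⇝_ S a b ⇔ _⇝_ T (f a) (f b))

_≐_ : {𝒜 : Set} → (𝒜 → Set) → (𝒜 → Set) → Set
P ≐ Q = ∀ A → (P A ⇔ Q A)

{-# OPTIONS --safe #-}
-- Every node v of S has a leaf below it, and that leaf carries a label A, so f v lies above the
-- node of T labelled A ∈ 𝒜(S), i.e. in T|𝒜(S); a path of T between nodes of T|𝒜(S) stays in
-- T|𝒜(S), so f remains a weak topological embedding into the restriction. A leaf l of S stays a
-- leaf: a child of f l in T|𝒜(S) lies above some f s, so l ⇝ s, hence s = l and T has a cycle.
-- Conversely a leaf of T|𝒜(S) labelled A is f s for the node s labelled A in S, and a child of s
-- would give a child of f s in the restriction. Constructively, finding a leaf below a node needs
-- decidable edges; in a finite tree these come from the uniqueness of root paths.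
module Submission where

open import Defs
open import Data.Product using (Σ; _×_; _,_)
open import Data.Product using (proj₁; proj₂; ∃-syntax; -,_)
open import Data.Empty using (⊥; ⊥-elim)
open import Data.Sum using (_⊎_; inj₁; inj₂)
open import Data.Maybe using (Maybe; just; nothing)
open import Data.Maybe.Properties using (just-injective)
open import Data.Nat using (ℕ; suc; _+_; _∸_; _<_; _≤_)
open import Data.Nat.Properties using (+-suc; m≢1+n+m; ∸-monoʳ-<; ≤-reflexive)
open import Data.Nat.Induction using (<-wellFounded)
open import Data.List using (List)
open import Data.List.Extrema.Nat using (argmax; f[xs]≤f[argmax])
import Data.List.Relation.Unary.All as All
open import Data.List.Relation.Unary.Any using (index; any?; satisfied)
open import Data.List.Membership.Propositional using (_∈_; lose)
open import Data.List.Membership.Setoid.Properties using (index-injective)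
import Data.Fin.Properties as Fin
open import Function.Base using (id; flip; _∘_)
open import Function.Bundles using (Equivalence; mk⇔)
open import Induction.WellFounded using (WellFounded; Acc; acc; module Subrelation)
import Relation.Binary.Construct.On as On
open import Relation.Binary.Definitions using (Decidable; DecidableEquality)
open import Relation.Nullary using (¬_; yes; no)
open import Relation.Nullary.Decidable using (map′)
open import Relation.Unary using (_⊆_)
open import Relation.Binary.PropositionalEquality

module _ {W : Set} {R : W → W → Set} where

  _++ₚ_ : ∀ {a b c} → Path R a b → Path R b c → Path R a c
  [] ++ₚ q = q
  (e ∷ p) ++ₚ q = e ∷ (p ++ₚ q)

  _∷ʳ_ : ∀ {a b c} → Path R a b → R b c → Path R a c
  p ∷ʳ e = p ++ₚ (e ∷ [])

  length : ∀ {a b} → Path R a b → ℕ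
  length [] = 0
  length (_ ∷ p) = suc (length p)

  length-∷ʳ : ∀ {a b c} (p : Path R a b) (e : R b c) → length (p ∷ʳ e) ≡ suc (length p)
  length-∷ʳ [] e = refl
  length-∷ʳ (_ ∷ p) e = cong suc (length-∷ʳ p e)

  last-edge : ∀ {a b} → Path R a b → Maybe (∃[ u ] R u b)
  last-edge [] = nothing
  last-edge (e ∷ []) = just (-, e)
  last-edge (_ ∷ p@(_ ∷ _)) = last-edge p

  last-edge-∷ʳ : ∀ {a b c} (p : Path R a b) (e : R b c) → last-edge (p ∷ʳ e) ≡ just (b , e)
  last-edge-∷ʳ [] e = refl
  last-edge-∷ʳ (_ ∷ []) e = refl
  last-edge-∷ʳ (_ ∷ p@(_ ∷ _)) e = last-edge-∷ʳ p e

  uncons : ∀ {a b} → Path R a b → a ≡ b ⊎ ∃[ z ] (R a z × Path R z b)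
  uncons [] = inj₁ refl
  uncons (e ∷ p) = inj₂ (-, e , p)

module _ {𝒜 : Set} (G : LGraph 𝒜) where

  Acyclic : Set
  Acyclic = ∀ {x y} → E G x y → Path (E G) y x → ⊥

  leaf-⇝ : ∀ {l v} → IsLeaf G l → Path (E G) l v → l ≡ v
  leaf-⇝ leaf [] = refl
  leaf-⇝ leaf (e ∷ _) = ⊥-elim (leaf _ e)

  finite-≟ : Finite G → DecidableEquality (V G)
  finite-≟ (_ , mem) v w =
    map′ (index-injective (setoid (V G)) (mem v) (mem w)) (λ { refl → refl })
         (index (mem v) Fin.≟ index (mem w))

module RootedTree {𝒜 : Set} (G : LGraph 𝒜) (r : V G)
                  (unique : ∀ v → Σ (Path (E G) r v) λ p → ∀ q → q ≡ p) where

  rootPath : ∀ v → Path (E G) r v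
  rootPath v = proj₁ (unique v)

  rootPath-∷ʳ : ∀ {v w} (e : E G v w) → rootPath v ∷ʳ e ≡ rootPath w
  rootPath-∷ʳ {w = w} e = proj₂ (unique w) _

  depth : V G → ℕ
  depth v = length (rootPath v)

  depth-child : ∀ {v w} → E G v w → depth w ≡ suc (depth v)
  depth-child {v} e = trans (cong length (sym (rootPath-∷ʳ e))) (length-∷ʳ (rootPath v) e)

  depth-⇝ : ∀ {x y} (p : Path (E G) x y) → depth y ≡ length p + depth x
  depth-⇝ [] = refl
  depth-⇝ {x} (e ∷ p) = begin
    depth _                    ≡⟨ depth-⇝ p ⟩
    length p + depth _         ≡⟨ cong (length p +_) (depth-child e) ⟩
    length p + suc (depth x)   ≡⟨ +-suc (length p) (depth x) ⟩
    suc (length p + depth x)   ∎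
    where open ≡-Reasoning

  acyclic : Acyclic G
  acyclic {x} e c = m≢1+n+m (depth x) (depth-⇝ (e ∷ c))

  last-edge-rootPath : ∀ {v w} (e : E G v w) → last-edge (rootPath w) ≡ just (v , e)
  last-edge-rootPath {v} e = trans (cong last-edge (sym (rootPath-∷ʳ e))) (last-edge-∷ʳ (rootPath v) e)

  -- An edge into w can only be the last edge of the root path of w.
  E? : DecidableEquality (V G) → Decidable (E G)
  E? _≟_ v w with last-edge (rootPath w) in eq
  ... | nothing = no λ e → nothing≢just (trans (sym eq) (last-edge-rootPath e))
    where nothing≢just : ∀ {x : ∃[ u ] E G u w} → nothing ≢ just x
          nothing≢just ()
  ... | just (u , e) with u ≟ v
  ...   | yes refl = yes e
  ...   | no u≢v = no λ e′ → u≢v (cong proj₁ (just-injective (trans (sym eq) (last-edge-rootPath e′))))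

  module _ (finite : Finite G) where

    private
      nodes : List (V G)
      nodes = proj₁ finite

      mem : ∀ v → v ∈ nodes
      mem = proj₂ finite

    deepest : V G
    deepest = argmax depth r nodes

    depth≤deepest : ∀ v → depth v ≤ depth deepest
    depth≤deepest v = All.lookup (f[xs]≤f[argmax] {f = depth} r nodes) (mem v)

    child-wellFounded : WellFounded (flip (E G))
    child-wellFounded = Subrelation.wellFounded height-decreasing (On.wellFounded height <-wellFounded)
      where
      height : V G → ℕ
      height v = depth deepest ∸ depth v

      height-decreasing : ∀ {w v} → E G v w → height w < height v
      height-decreasing {w} e = ∸-monoʳ-< (≤-reflexive (sym (depth-child e))) (depth≤deepest w)

    leaf-below : ∀ v → ∃[ l ] (Path (E G) v l × IsLeaf G l)
    leaf-below v = descend v (child-wellFounded v)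
      where
      descend : ∀ v → Acc (flip (E G)) v → ∃[ l ] (Path (E G) v l × IsLeaf G l)
      descend v (acc below) with any? (E? (finite-≟ G finite) v) nodes
      ... | no childless = v , [] , λ w e → childless (lose (mem w) e)
      ... | yes has-child with w , e ← satisfied has-child
                          with l , p , leaf ← descend w (below e)
                          = l , e ∷ p , leaf

tree-acyclic : {𝒜 : Set} (G : LGraph 𝒜) → IsTree G → Acyclic G
tree-acyclic G (inj₁ empty) {x} = ⊥-elim (empty x)
tree-acyclic G (inj₂ (r , unique)) = RootedTree.acyclic G r unique

module _ {𝒜 : Set} {G : LGraph 𝒜} where

  leaf-below : IsATree G → ∀ v → ∃[ l ] (Path (E G) v l × IsLeaf G l)
  leaf-below G-tree v with IsATree.tree G-tree
  ... | inj₁ empty = ⊥-elim (empty v)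
  ... | inj₂ (r , unique) = RootedTree.leaf-below G r unique (IsATree.finite G-tree) v

  labelled-descendant : IsATree G → ∀ v → ∃[ A ] DescLabels G v A
  labelled-descendant G-tree v with l , p , leaf ← leaf-below G-tree v
                               with A , lab ← IsATree.leavesLab G-tree l leaf
                               = A , l , p , lab

module _ {𝒜 : Set} (T : LGraph 𝒜) (X : 𝒜 → Set) where

  InRestr-⇝ : ∀ {x y} → Path (E T) x y → InRestr T X y → InRestr T X x
  InRestr-⇝ p (A , xA , w , q , lab) = A , xA , w , p ++ₚ q , lab

  -- The path must be nonempty: a node of the restriction carries a proof of InRestr, and a
  -- trivial path would force hx ≡ hz.
  restrict-path : ∀ {x y z} (e : E T x y) (p : Path (E T) y z) hx hz →
                  Path (E (restrict T X)) (x , hx) (z , hz)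
  restrict-path e [] hx hz = e ∷ []
  restrict-path e (e′ ∷ p) hx hz = e ∷ restrict-path e′ p (InRestr-⇝ (e′ ∷ p) hz) hz

  unrestrict-path : ∀ {a b} → Path (E (restrict T X)) a b → Path (E T) (proj₁ a) (proj₁ b)
  unrestrict-path [] = []
  unrestrict-path (e ∷ p) = e ∷ unrestrict-path p

module WTE {𝒜 : Set} {S T : LGraph 𝒜} {f : V S → V T} (f-wte : IsWTE S T f) where
  open IsWTE f-wte

  ⇝-image : ∀ {a b} → Path (E S) a b → Path (E T) (f a) (f b)
  ⇝-image {a} {b} = Equivalence.to (pathsIff a b)

  ⇝-preimage : ∀ {a b} → Path (E T) (f a) (f b) → Path (E S) a b
  ⇝-preimage {a} {b} = Equivalence.from (pathsIff a b)

  DescLabels-image : ∀ {v A} → DescLabels S v A → DescLabels T (f v) A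
  DescLabels-image (w , p , lab) = f w , ⇝-image p , preservesLabels w _ lab

  leaf-reflect : Acyclic S → ∀ {a} → IsLeaf T (f a) → IsLeaf S a
  leaf-reflect acyclic {a} leaf t e with refl ← injective a t (leaf-⇝ T leaf (⇝-image (e ∷ [])))
    = acyclic e []

module _ {𝒜 : Set} {S T : LGraph 𝒜} {f : V S → V T} (f-wte : IsWTE S T f) where
  open IsWTE f-wte
  open WTE f-wte

  into-restriction : ∀ {X} (h : ∀ v → InRestr T X (f v)) → Labels S ⊆ X →
                     IsWTE S (restrict T X) (λ v → f v , h v)
  into-restriction {X} h S⊆X = record
    { injective = λ a b → injective a b ∘ cong proj₁
    ; preservesLabels = λ v A lab → preservesLabels v A lab , S⊆X (v , lab)
    ; pathsIff = λ a b → mk⇔ (lift a b) (⇝-preimage ∘ unrestrict-path T X)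
    }
    where
    lift : ∀ a b → Path (E S) a b → Path (E (restrict T X)) (f a , h a) (f b , h b)
    lift a b p with uncons (⇝-image p)
    ... | inj₂ (_ , e , q) = restrict-path T X e q (h a) (h b)
    ... | inj₁ fa≡fb with refl ← injective a b fa≡fb = []

  image-InRestr : IsATree S → ∀ v → InRestr T (Labels S) (f v)
  image-InRestr S-tree v with A , w , p , lab ← labelled-descendant S-tree v
    = A , (w , lab) , DescLabels-image (w , p , lab)

  InRestr⇒⇝-image : InjLabelled T → ∀ {w} → InRestr T (Labels S) w → ∃[ s ] Path (E T) w (f s)
  InRestr⇒⇝-image (_ , unique) (A , (s , labS) , w′ , p , labT)
    with refl ← unique w′ (f s) A labT (preservesLabels s A labS) = s , p

  leaf-image-child-∉-restriction : Acyclic T → InjLabelled T → ∀ {l w} → IsLeaf S l →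
                                   E T (f l) w → ¬ InRestr T (Labels S) w
  leaf-image-child-∉-restriction acyclic injLab leaf e hw
    with s , p ← InRestr⇒⇝-image injLab hw
    with refl ← leaf-⇝ S leaf (⇝-preimage (e ∷ p))
    = acyclic e p

  LeafLabels-restrict : IsATree S → IsATree T → LeafLabels S ≐ LeafLabels (restrict T (Labels S))
  LeafLabels-restrict S-tree T-tree A = mk⇔ to from
    where
    h : ∀ v → InRestr T (Labels S) (f v)
    h = image-InRestr S-tree

    open IsATree T-tree using (injLab; tree)

    to : LeafLabels S A → LeafLabels (restrict T (Labels S)) A
    to (l , leaf , lab) =
      (f l , h l) ,
      (λ (_ , hw) e → leaf-image-child-∉-restriction (tree-acyclic T tree) injLab leaf e hw) ,
      preservesLabels l A lab , (l , lab)

    from : LeafLabels (restrict T (Labels S)) A → LeafLabels S A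
    from ((w , _) , leaf , labT , s , labS)
      with refl ← proj₂ injLab w (f s) A labT (preservesLabels s A labS)
      = s , WTE.leaf-reflect (into-restriction h id) (tree-acyclic S (IsATree.tree S-tree)) leaf , labS

lemma4 : {𝒜 : Set} (S T : LGraph 𝒜) → IsATree S → IsATree T →
         (f : V S → V T) → IsWTE S T f →
         (LeafLabels S ≐ LeafLabels (restrict T (Labels S)))
         × Σ (∀ v → InRestr T (Labels S) (f v))
             (λ h → IsWTE S (restrict T (Labels S)) (λ v → f v , h v))
lemma4 S T S-tree T-tree f f-wte =
  LeafLabels-restrict f-wte S-tree T-tree , h , into-restriction f-wte h id
  where
  h : ∀ v → InRestr T (Labels S) (f v)
  h = image-InRestr f-wte S-tree
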